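{- (i) For any positive integer $n$, as a polynomial identity in $x,y$, $$\sum_{\substack{i,j\in\{0,1,2,\ldots\}\\ i+j=n}} (i-j)\binom xi\binom yj=(x-y)\binom{x+y-1}{n-1}.$$ (ii) For any odd prime $p$ and $i,j\in\{0,1,2,\ldots\}$ with $i+j=p-2$, we have $$(i-j)\binom{p-1}i\binom{ -p-1}j\equiv j-i-2p\pmod{p^2}.$$
   Context: $\binom xk=x(x-1)\cdots(x-k+1)/k!$ for $k\in\{0,1,2,\ldots\}$ and any $x$. -}

module Defs where

open import Data.Nat as ℕ using (ℕ; zero; suc)
open import Data.Nat.Properties using (_!≢0)
open import Data.Nat using (_!)
open import Data.Integer as ℤ using (ℤ; +_)
open import Data.Rational using (ℚ; _+_; _*_; _-_; _/_; 0ℚ; 1ℚ)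

ι : ℕ → ℚ
ι k = + k / 1

fall : ℚ → ℕ → ℚ
fall x zero    = 1ℚ
fall x (suc k) = fall x k * (x - ι k)

binom : ℚ → ℕ → ℚ
binom x k = fall x k * ((+ 1 / (k !)) {{k !≢0}})

Σ≤ : ℕ → (ℕ → ℚ) → ℚ
Σ≤ zero    f = f zero
Σ≤ (suc n) f = Σ≤ n f + f (suc n)

module Submission where

-- (i)  Write V n x y = Σ_{i+j=n} C(x,i) C(y,j).  The absorption identity
--      (k+1) C(x,k+1) = x C(x-1,k) turns the weighted sums Σ i C(x,i)C(y,j) and
--      Σ j C(x,i)C(y,j) (over i+j = n+1) into x V n (x-1) y and y V n x (y-1).
--      Adding the two gives the recursion that proves Vandermonde's identity
--      V n x y = C(x+y,n); subtracting them and applying Vandermonde gives (i).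
--
-- (ii) Let x = p-1, y = -p-1 and z = C(x,i) C(y,j) with i+j = p-2.  Pascal's rule
--      shows that C(a,k) is an integer for every integer a, so z ∈ ℤ.  By induction
--      on j we prove the congruence  (i+1)(z+1) + p ≡ 0 (mod p²):  for j = 0 it reads
--      (p-1)p + p = p², and the ratio of consecutive terms z turns the congruence
--      at (i+1, j) into (j+1)(j+2)(i+2) times the one at (i, j+1); these factors are
--      prime to p and can be cancelled.  The congruence gives p ∣ z+1, and then
--      (i-j) z - (j-i-2p) = 2((i+1)(z+1) + p) - p(z+1) ≡ 0 (mod p²).

open import Defs
open import Data.Nat as ℕ using (ℕ; zero; suc; _∸_; _≤_; _<_; z≤n; s≤s; _!)
import Data.Nat.Properties as ℕP
open import Data.Nat.Properties using (_!≢0)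
open import Data.Nat.Coprimality using (Coprime; coprime-divisor; prime⇒coprime)
open import Data.Nat.Divisibility using (∣-trans)
open import Data.Nat.Primality using (Prime; prime⇒nonTrivial)
open import Data.Integer as ℤ using (ℤ; +_; -[1+_])
import Data.Integer.Properties as ℤP
import Data.Integer.Coprimality as ℤCoprime
import Data.Integer.Divisibility as ℤDiv
open import Data.Integer.Divisibility.Signed using (∣ᵤ⇒∣; divides)
open import Data.Rational using (ℚ; _+_; _*_; _-_; -_; _/_; 0ℚ; 1ℚ; 1/_; toℚᵘ; NonZero; ≢-nonZero)
open import Data.Rational.Properties as ℚP using (toℚᵘ-injective; toℚᵘ-fromℚᵘ)
open import Data.Rational.Solver using (module +-*-Solver)
import Data.Rational.Unnormalised as ℚᵘ
import Data.Rational.Unnormalised.Properties as ℚᵘP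
open import Data.Product using (Σ; _×_; _,_; ∃; proj₁; proj₂)
open import Relation.Nullary using (yes; no)
open import Relation.Binary.PropositionalEquality
open ≡-Reasoning
open +-*-Solver

-- The embedding of ℤ into ℚ (ι is its restriction to ℕ).  Its ring laws are
-- checked on unnormalised rationals, where m / 1 is just the fraction m/1.
emb : ℤ → ℚ
emb m = m / 1

emb-via-ℚᵘ : ∀ {q} m → toℚᵘ q ℚᵘ.≃ ℚᵘ.mkℚᵘ m 0 → q ≡ emb m
emb-via-ℚᵘ m q≃m = toℚᵘ-injective (ℚᵘP.≃-trans q≃m (ℚᵘP.≃-sym (toℚᵘ-fromℚᵘ (ℚᵘ.mkℚᵘ m 0))))

emb-+ : ∀ a b → emb (a ℤ.+ b) ≡ emb a + emb b
emb-+ a b = sym (emb-via-ℚᵘ (a ℤ.+ b)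
  (ℚᵘP.≃-trans (ℚP.toℚᵘ-homo-+ (emb a) (emb b))
  (ℚᵘP.≃-trans (ℚᵘP.+-cong (toℚᵘ-fromℚᵘ (ℚᵘ.mkℚᵘ a 0)) (toℚᵘ-fromℚᵘ (ℚᵘ.mkℚᵘ b 0)))
  (ℚᵘ.*≡* (cong (ℤ._* + 1) (cong₂ ℤ._+_ (ℤP.*-identityʳ a) (ℤP.*-identityʳ b)))))))

emb-* : ∀ a b → emb (a ℤ.* b) ≡ emb a * emb b
emb-* a b = sym (emb-via-ℚᵘ (a ℤ.* b)
  (ℚᵘP.≃-trans (ℚP.toℚᵘ-homo-* (emb a) (emb b))
  (ℚᵘP.*-cong (toℚᵘ-fromℚᵘ (ℚᵘ.mkℚᵘ a 0)) (toℚᵘ-fromℚᵘ (ℚᵘ.mkℚᵘ b 0)))))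

emb-neg : ∀ a → emb (ℤ.- a) ≡ - emb a
emb-neg a = sym (emb-via-ℚᵘ (ℤ.- a)
  (ℚᵘP.≃-trans (ℚP.toℚᵘ-homo‿- (emb a)) (ℚᵘP.-‿cong (toℚᵘ-fromℚᵘ (ℚᵘ.mkℚᵘ a 0)))))

emb-- : ∀ a b → emb (a ℤ.- b) ≡ emb a - emb b
emb-- a b = trans (emb-+ a (ℤ.- b)) (cong (λ t → emb a + t) (emb-neg b))

emb-injective : ∀ {a b} → emb a ≡ emb b → a ≡ b
emb-injective {a} {b} eq with ℚᵘP.≃-trans (ℚᵘP.≃-sym (toℚᵘ-fromℚᵘ (ℚᵘ.mkℚᵘ a 0)))
                               (ℚᵘP.≃-trans (ℚᵘP.≃-reflexive (cong toℚᵘ eq)) (toℚᵘ-fromℚᵘ (ℚᵘ.mkℚᵘ b 0)))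
... | ℚᵘ.*≡* a*1≡b*1 = trans (sym (ℤP.*-identityʳ a)) (trans a*1≡b*1 (ℤP.*-identityʳ b))

ι-+ : ∀ m n → ι (m ℕ.+ n) ≡ ι m + ι n
ι-+ m n = trans (cong emb (ℤP.pos-+ m n)) (emb-+ (+ m) (+ n))

ι-* : ∀ m n → ι (m ℕ.* n) ≡ ι m * ι n
ι-* m n = trans (cong emb (ℤP.pos-* m n)) (emb-* (+ m) (+ n))

ι-suc : ∀ k → ι (suc k) ≡ ι k + 1ℚ
ι-suc k = trans (ι-+ 1 k) (ℚP.+-comm 1ℚ (ι k))

ι-2+ : ∀ k → ι (suc (suc k)) ≡ ι k + ι 2
ι-2+ k = trans (cong ι (ℕP.+-comm 2 k)) (ι-+ k 2)

*-cancelˡ-ι : ∀ k {a b} → ι (suc k) * a ≡ ι (suc k) * b → a ≡ b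
*-cancelˡ-ι k {a} {b} ca≡cb = begin
    a                ≡⟨ sym (ℚP.*-identityˡ a) ⟩
    1ℚ * a           ≡⟨ cong (_* a) (sym (ℚP.*-inverseˡ c)) ⟩
    (1/ c * c) * a   ≡⟨ ℚP.*-assoc (1/ c) c a ⟩
    1/ c * (c * a)   ≡⟨ cong (1/ c *_) ca≡cb ⟩
    1/ c * (c * b)   ≡⟨ sym (ℚP.*-assoc (1/ c) c b) ⟩
    (1/ c * c) * b   ≡⟨ cong (_* b) (ℚP.*-inverseˡ c) ⟩
    1ℚ * b           ≡⟨ ℚP.*-identityˡ b ⟩
    b                ∎
  where
  c : ℚ
  c = ι (suc k)
  c≢0 : c ≢ 0ℚ
  c≢0 c≡0 with emb-injective {+ suc k} {+ 0} c≡0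
  ... | ()
  instance
    c-nonZero : NonZero c
    c-nonZero = ≢-nonZero c≢0

-- The factor 1/k! in C(x,k) satisfies 1/(n+1)! · (n+1) = 1/n!, stated for any
-- nonzero d in place of n!.
reciprocal-*-cancel : ∀ n d .{{_ : ℕ.NonZero d}} .{{_ : ℕ.NonZero (suc n ℕ.* d)}} →
                      (+ 1 / (suc n ℕ.* d)) * ι (suc n) ≡ + 1 / d
reciprocal-*-cancel n (suc d) = toℚᵘ-injective
  (ℚᵘP.≃-trans (ℚP.toℚᵘ-homo-* (+ 1 / (suc n ℕ.* suc d)) (ι (suc n)))
  (ℚᵘP.≃-trans (ℚᵘP.*-cong (toℚᵘ-fromℚᵘ (ℚᵘ.mkℚᵘ (+ 1) (d ℕ.+ n ℕ.* suc d)))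
                            (toℚᵘ-fromℚᵘ (ℚᵘ.mkℚᵘ (+ suc n) 0)))
  (ℚᵘP.≃-trans (ℚᵘ.*≡* cross-multiplied) (ℚᵘP.≃-sym (toℚᵘ-fromℚᵘ (ℚᵘ.mkℚᵘ (+ 1) d))))))
  where
  cross-multiplied : (+ 1 ℤ.* + suc n) ℤ.* + suc d ≡ + 1 ℤ.* + (suc (d ℕ.+ n ℕ.* suc d) ℕ.* 1)
  cross-multiplied = begin
    (+ 1 ℤ.* + suc n) ℤ.* + suc d            ≡⟨ cong (ℤ._* + suc d) (ℤP.*-identityˡ (+ suc n)) ⟩
    + suc n ℤ.* + suc d                      ≡⟨ sym (ℤP.pos-* (suc n) (suc d)) ⟩
    + (suc n ℕ.* suc d)                      ≡⟨ cong +_ (sym (ℕP.*-identityʳ _)) ⟩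
    + (suc n ℕ.* suc d ℕ.* 1)                ≡⟨ sym (ℤP.*-identityˡ _) ⟩
    + 1 ℤ.* + (suc (d ℕ.+ n ℕ.* suc d) ℕ.* 1) ∎

binom-suc : ∀ x k → binom x (suc k) * ι (suc k) ≡ binom x k * (x - ι k)
binom-suc x k = begin
    fall x k * (x - ι k) * r (suc k) * ι (suc k)
      ≡⟨ solve 4 (λ f a r c → f :* a :* r :* c := f :* (r :* c) :* a) refl (fall x k) (x - ι k) (r (suc k)) (ι (suc k)) ⟩
    fall x k * (r (suc k) * ι (suc k)) * (x - ι k)
      ≡⟨ cong (λ t → fall x k * t * (x - ι k)) (reciprocal-*-cancel k (k !) {{k !≢0}} {{suc k !≢0}}) ⟩
    fall x k * r k * (x - ι k) ∎
  where
  r : ℕ → ℚ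
  r k = (+ 1 / (k !)) {{k !≢0}}

absorption : ∀ x k → binom x (suc k) * ι (suc k) ≡ x * binom (x - 1ℚ) k
absorption x zero = trans (binom-suc x 0) (solve 1 (λ x → con 1ℚ :* (x :- con 0ℚ) := x :* con 1ℚ) refl x)
absorption x (suc k) = *-cancelˡ-ι k (begin
    ι (suc k) * (binom x (suc (suc k)) * ι (suc (suc k)))
      ≡⟨ cong (ι (suc k) *_) (binom-suc x (suc k)) ⟩
    ι (suc k) * (binom x (suc k) * (x - ι (suc k)))
      ≡⟨ solve 3 (λ c b a → c :* (b :* a) := (b :* c) :* a) refl (ι (suc k)) (binom x (suc k)) (x - ι (suc k)) ⟩
    binom x (suc k) * ι (suc k) * (x - ι (suc k))
      ≡⟨ cong₂ (λ s t → s * (x - t)) (absorption x k) (ι-suc k) ⟩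
    x * binom (x - 1ℚ) k * (x - (ι k + 1ℚ))
      ≡⟨ solve 4 (λ x b k one → x :* b :* (x :- (k :+ one)) := x :* (b :* ((x :- one) :- k))) refl x (binom (x - 1ℚ) k) (ι k) 1ℚ ⟩
    x * (binom (x - 1ℚ) k * ((x - 1ℚ) - ι k))
      ≡⟨ cong (x *_) (sym (binom-suc (x - 1ℚ) k)) ⟩
    x * (binom (x - 1ℚ) (suc k) * ι (suc k))
      ≡⟨ solve 3 (λ x b c → x :* (b :* c) := c :* (x :* b)) refl x (binom (x - 1ℚ) (suc k)) (ι (suc k)) ⟩
    ι (suc k) * (x * binom (x - 1ℚ) (suc k)) ∎)

pascal : ∀ x k → binom (x + 1ℚ) (suc k) ≡ binom x (suc k) + binom x k
pascal x k = *-cancelˡ-ι k (begin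
    ι (suc k) * binom (x + 1ℚ) (suc k)
      ≡⟨ ℚP.*-comm (ι (suc k)) (binom (x + 1ℚ) (suc k)) ⟩
    binom (x + 1ℚ) (suc k) * ι (suc k)
      ≡⟨ absorption (x + 1ℚ) k ⟩
    (x + 1ℚ) * binom (x + 1ℚ - 1ℚ) k
      ≡⟨ cong (λ t → (x + 1ℚ) * binom t k) (solve 1 (λ x → x :+ con 1ℚ :- con 1ℚ := x) refl x) ⟩
    (x + 1ℚ) * binom x k
      ≡⟨ solve 3 (λ x b k → (x :+ con 1ℚ) :* b := b :* (x :- k) :+ b :* (k :+ con 1ℚ)) refl x (binom x k) (ι k) ⟩
    binom x k * (x - ι k) + binom x k * (ι k + 1ℚ)
      ≡⟨ cong₂ _+_ (sym (binom-suc x k)) (cong (binom x k *_) (sym (ι-suc k))) ⟩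
    binom x (suc k) * ι (suc k) + binom x k * ι (suc k)
      ≡⟨ solve 3 (λ a b c → a :* c :+ b :* c := c :* (a :+ b)) refl (binom x (suc k)) (binom x k) (ι (suc k)) ⟩
    ι (suc k) * (binom x (suc k) + binom x k) ∎)

-- C(n,k) = 0 for naturals n < k: the falling factorial contains the factor n - n.
binom-vanishes : ∀ {n k} → n < k → binom (ι n) k ≡ 0ℚ
binom-vanishes {n} {k} n<k = begin
    fall (ι n) k * (+ 1 / (k !)) {{k !≢0}}  ≡⟨ cong (_* (+ 1 / (k !)) {{k !≢0}}) (fall-vanishes n<k) ⟩
    0ℚ * (+ 1 / (k !)) {{k !≢0}}            ≡⟨ ℚP.*-zeroˡ ((+ 1 / (k !)) {{k !≢0}}) ⟩
    0ℚ                                      ∎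
  where
  fall-vanishes : ∀ {k} → n < k → fall (ι n) k ≡ 0ℚ
  fall-vanishes {suc k} n<1+k with n ℕ.≟ k
  ... | yes refl = trans (cong (fall (ι n) n *_) (ℚP.+-inverseʳ (ι n))) (ℚP.*-zeroʳ (fall (ι n) n))
  ... | no n≢k   = trans (cong (_* (ι n - ι k)) (fall-vanishes (ℕP.≤∧≢⇒< (ℕ.s≤s⁻¹ n<1+k) n≢k)))
                         (ℚP.*-zeroˡ (ι n - ι k))

binom-diagonal : ∀ n → binom (ι n) n ≡ 1ℚ
binom-diagonal zero    = refl
binom-diagonal (suc n) = begin
    binom (ι (suc n)) (suc n)             ≡⟨ cong (λ t → binom t (suc n)) (ι-suc n) ⟩
    binom (ι n + 1ℚ) (suc n)              ≡⟨ pascal (ι n) n ⟩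
    binom (ι n) (suc n) + binom (ι n) n   ≡⟨ cong₂ _+_ (binom-vanishes (ℕP.n<1+n n)) (binom-diagonal n) ⟩
    0ℚ + 1ℚ                               ≡⟨ ℚP.+-identityˡ 1ℚ ⟩
    1ℚ                                    ∎

binom-subdiagonal : ∀ n → binom (ι (suc n)) n ≡ ι (suc n)
binom-subdiagonal zero    = refl
binom-subdiagonal (suc n) = begin
    binom (ι (suc (suc n))) (suc n)                   ≡⟨ cong (λ t → binom t (suc n)) (ι-suc (suc n)) ⟩
    binom (ι (suc n) + 1ℚ) (suc n)                    ≡⟨ pascal (ι (suc n)) n ⟩
    binom (ι (suc n)) (suc n) + binom (ι (suc n)) n   ≡⟨ cong₂ _+_ (binom-diagonal (suc n)) (binom-subdiagonal n) ⟩
    1ℚ + ι (suc n)                                    ≡⟨ ℚP.+-comm 1ℚ (ι (suc n)) ⟩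
    ι (suc n) + 1ℚ                                    ≡⟨ sym (ι-suc (suc n)) ⟩
    ι (suc (suc n))                                   ∎

binom-product-ratio : ∀ x y i j →
  binom x (suc i) * binom y j * ι (suc i) * (y - ι j) ≡ binom x i * binom y (suc j) * (x - ι i) * ι (suc j)
binom-product-ratio x y i j = begin
    binom x (suc i) * binom y j * ι (suc i) * (y - ι j)
      ≡⟨ solve 4 (λ a b c d → a :* b :* c :* d := (a :* c) :* (b :* d)) refl (binom x (suc i)) (binom y j) (ι (suc i)) (y - ι j) ⟩
    (binom x (suc i) * ι (suc i)) * (binom y j * (y - ι j))
      ≡⟨ cong₂ _*_ (binom-suc x i) (sym (binom-suc y j)) ⟩
    (binom x i * (x - ι i)) * (binom y (suc j) * ι (suc j))
      ≡⟨ solve 4 (λ a b c d → (a :* c) :* (b :* d) := a :* b :* c :* d) refl (binom x i) (binom y (suc j)) (x - ι i) (ι (suc j)) ⟩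
    binom x i * binom y (suc j) * (x - ι i) * ι (suc j) ∎

Σ-cong : ∀ n {f g : ℕ → ℚ} → (∀ i → i ≤ n → f i ≡ g i) → Σ≤ n f ≡ Σ≤ n g
Σ-cong zero    f≗g = f≗g 0 z≤n
Σ-cong (suc n) f≗g = cong₂ _+_ (Σ-cong n (λ i i≤n → f≗g i (ℕP.m≤n⇒m≤1+n i≤n))) (f≗g (suc n) ℕP.≤-refl)

Σ-+ : ∀ n (f g : ℕ → ℚ) → Σ≤ n (λ i → f i + g i) ≡ Σ≤ n f + Σ≤ n g
Σ-+ zero    f g = refl
Σ-+ (suc n) f g = trans (cong (_+ (f (suc n) + g (suc n))) (Σ-+ n f g))
  (solve 4 (λ a b c d → (a :+ b) :+ (c :+ d) := (a :+ c) :+ (b :+ d)) refl (Σ≤ n f) (Σ≤ n g) (f (suc n)) (g (suc n)))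

Σ-- : ∀ n (f g : ℕ → ℚ) → Σ≤ n (λ i → f i - g i) ≡ Σ≤ n f - Σ≤ n g
Σ-- zero    f g = refl
Σ-- (suc n) f g = trans (cong (_+ (f (suc n) - g (suc n))) (Σ-- n f g))
  (solve 4 (λ a b c d → (a :- b) :+ (c :- d) := (a :+ c) :- (b :+ d)) refl (Σ≤ n f) (Σ≤ n g) (f (suc n)) (g (suc n)))

Σ-* : ∀ n c (f : ℕ → ℚ) → Σ≤ n (λ i → c * f i) ≡ c * Σ≤ n f
Σ-* zero    c f = refl
Σ-* (suc n) c f = trans (cong (_+ (c * f (suc n))) (Σ-* n c f)) (sym (ℚP.*-distribˡ-+ c (Σ≤ n f) (f (suc n))))

Σ-shift : ∀ n (f : ℕ → ℚ) → Σ≤ (suc n) f ≡ f 0 + Σ≤ n (λ i → f (suc i))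
Σ-shift zero    f = refl
Σ-shift (suc n) f = trans (cong (_+ f (suc (suc n))) (Σ-shift n f))
  (ℚP.+-assoc (f 0) (Σ≤ n (λ i → f (suc i))) (f (suc (suc n))))

convolution : ℕ → ℚ → ℚ → ℚ
convolution n x y = Σ≤ n (λ i → binom x i * binom y (n ∸ i))

Σ-weighted-left : ∀ n x y →
  Σ≤ (suc n) (λ i → ι i * binom x i * binom y (suc n ∸ i)) ≡ x * convolution n (x - 1ℚ) y
Σ-weighted-left n x y = begin
    Σ≤ (suc n) (λ i → ι i * binom x i * binom y (suc n ∸ i))
      ≡⟨ Σ-shift n (λ i → ι i * binom x i * binom y (suc n ∸ i)) ⟩
    0ℚ * binom x 0 * binom y (suc n) + Σ≤ n (λ i → ι (suc i) * binom x (suc i) * binom y (n ∸ i))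
      ≡⟨ solve 3 (λ a b s → con 0ℚ :* a :* b :+ s := s) refl (binom x 0) (binom y (suc n)) _ ⟩
    Σ≤ n (λ i → ι (suc i) * binom x (suc i) * binom y (n ∸ i))
      ≡⟨ Σ-cong n (λ i _ → absorb-term i) ⟩
    Σ≤ n (λ i → x * (binom (x - 1ℚ) i * binom y (n ∸ i)))
      ≡⟨ Σ-* n x _ ⟩
    x * convolution n (x - 1ℚ) y ∎
  where
  absorb-term : ∀ i → ι (suc i) * binom x (suc i) * binom y (n ∸ i) ≡ x * (binom (x - 1ℚ) i * binom y (n ∸ i))
  absorb-term i = begin
    ι (suc i) * binom x (suc i) * binom y (n ∸ i)     ≡⟨ cong (_* binom y (n ∸ i)) (ℚP.*-comm (ι (suc i)) (binom x (suc i))) ⟩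
    binom x (suc i) * ι (suc i) * binom y (n ∸ i)     ≡⟨ cong (_* binom y (n ∸ i)) (absorption x i) ⟩
    x * binom (x - 1ℚ) i * binom y (n ∸ i)            ≡⟨ ℚP.*-assoc x (binom (x - 1ℚ) i) (binom y (n ∸ i)) ⟩
    x * (binom (x - 1ℚ) i * binom y (n ∸ i))          ∎

Σ-weighted-right : ∀ n x y →
  Σ≤ (suc n) (λ i → ι (suc n ∸ i) * binom x i * binom y (suc n ∸ i)) ≡ y * convolution n x (y - 1ℚ)
Σ-weighted-right n x y = begin
    Σ≤ n (λ i → ι (suc n ∸ i) * binom x i * binom y (suc n ∸ i)) + ι (n ∸ n) * binom x (suc n) * binom y (n ∸ n)
      ≡⟨ cong (λ t → Σ≤ n (λ i → ι (suc n ∸ i) * binom x i * binom y (suc n ∸ i)) + ι t * binom x (suc n) * binom y t) (ℕP.n∸n≡0 n) ⟩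
    Σ≤ n (λ i → ι (suc n ∸ i) * binom x i * binom y (suc n ∸ i)) + 0ℚ * binom x (suc n) * binom y 0
      ≡⟨ solve 3 (λ a b s → s :+ con 0ℚ :* a :* b := s) refl (binom x (suc n)) (binom y 0) _ ⟩
    Σ≤ n (λ i → ι (suc n ∸ i) * binom x i * binom y (suc n ∸ i))
      ≡⟨ Σ-cong n absorb-term ⟩
    Σ≤ n (λ i → y * (binom x i * binom (y - 1ℚ) (n ∸ i)))
      ≡⟨ Σ-* n y _ ⟩
    y * convolution n x (y - 1ℚ) ∎
  where
  absorb-term : ∀ i → i ≤ n → ι (suc n ∸ i) * binom x i * binom y (suc n ∸ i) ≡ y * (binom x i * binom (y - 1ℚ) (n ∸ i))
  absorb-term i i≤n rewrite ℕP.+-∸-assoc 1 i≤n = begin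
    ι (suc (n ∸ i)) * binom x i * binom y (suc (n ∸ i))
      ≡⟨ solve 3 (λ c a b → c :* a :* b := a :* (b :* c)) refl (ι (suc (n ∸ i))) (binom x i) (binom y (suc (n ∸ i))) ⟩
    binom x i * (binom y (suc (n ∸ i)) * ι (suc (n ∸ i)))
      ≡⟨ cong (binom x i *_) (absorption y (n ∸ i)) ⟩
    binom x i * (y * binom (y - 1ℚ) (n ∸ i))
      ≡⟨ solve 3 (λ a y b → a :* (y :* b) := y :* (a :* b)) refl (binom x i) y (binom (y - 1ℚ) (n ∸ i)) ⟩
    y * (binom x i * binom (y - 1ℚ) (n ∸ i)) ∎

shifted-arguments : ∀ x y → x - 1ℚ + y ≡ x + y - 1ℚ × x + (y - 1ℚ) ≡ x + y - 1ℚ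
shifted-arguments x y = solve 2 (λ x y → x :- con 1ℚ :+ y := x :+ y :- con 1ℚ) refl x y
                      , solve 2 (λ x y → x :+ (y :- con 1ℚ) := x :+ y :- con 1ℚ) refl x y

vandermonde : ∀ n x y → convolution n x y ≡ binom (x + y) n
vandermonde zero    x y = refl
vandermonde (suc n) x y = *-cancelˡ-ι n (begin
    ι (suc n) * convolution (suc n) x y
      ≡⟨ sym (Σ-* (suc n) (ι (suc n)) (λ i → binom x i * binom y (suc n ∸ i))) ⟩
    Σ≤ (suc n) (λ i → ι (suc n) * (binom x i * binom y (suc n ∸ i)))
      ≡⟨ Σ-cong (suc n) split-weight ⟩
    Σ≤ (suc n) (λ i → ι i * binom x i * binom y (suc n ∸ i) + ι (suc n ∸ i) * binom x i * binom y (suc n ∸ i))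
      ≡⟨ Σ-+ (suc n) _ _ ⟩
    Σ≤ (suc n) (λ i → ι i * binom x i * binom y (suc n ∸ i)) + Σ≤ (suc n) (λ i → ι (suc n ∸ i) * binom x i * binom y (suc n ∸ i))
      ≡⟨ cong₂ _+_ (Σ-weighted-left n x y) (Σ-weighted-right n x y) ⟩
    x * convolution n (x - 1ℚ) y + y * convolution n x (y - 1ℚ)
      ≡⟨ cong₂ (λ a b → x * a + y * b) (vandermonde n (x - 1ℚ) y) (vandermonde n x (y - 1ℚ)) ⟩
    x * binom (x - 1ℚ + y) n + y * binom (x + (y - 1ℚ)) n
      ≡⟨ cong₂ (λ a b → x * binom a n + y * binom b n) (proj₁ (shifted-arguments x y)) (proj₂ (shifted-arguments x y)) ⟩
    x * binom (x + y - 1ℚ) n + y * binom (x + y - 1ℚ) n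
      ≡⟨ sym (ℚP.*-distribʳ-+ (binom (x + y - 1ℚ) n) x y) ⟩
    (x + y) * binom (x + y - 1ℚ) n
      ≡⟨ sym (absorption (x + y) n) ⟩
    binom (x + y) (suc n) * ι (suc n)
      ≡⟨ ℚP.*-comm (binom (x + y) (suc n)) (ι (suc n)) ⟩
    ι (suc n) * binom (x + y) (suc n) ∎)
  where
  split-weight : ∀ i → i ≤ suc n → ι (suc n) * (binom x i * binom y (suc n ∸ i))
                   ≡ ι i * binom x i * binom y (suc n ∸ i) + ι (suc n ∸ i) * binom x i * binom y (suc n ∸ i)
  split-weight i i≤1+n = begin
    ι (suc n) * (binom x i * binom y (suc n ∸ i))
      ≡⟨ cong (λ t → ι t * (binom x i * binom y (suc n ∸ i))) (sym (ℕP.m+[n∸m]≡n i≤1+n)) ⟩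
    ι (i ℕ.+ (suc n ∸ i)) * (binom x i * binom y (suc n ∸ i))
      ≡⟨ cong (_* (binom x i * binom y (suc n ∸ i))) (ι-+ i (suc n ∸ i)) ⟩
    (ι i + ι (suc n ∸ i)) * (binom x i * binom y (suc n ∸ i))
      ≡⟨ solve 4 (λ a b c d → (a :+ b) :* (c :* d) := a :* c :* d :+ b :* c :* d) refl (ι i) (ι (suc n ∸ i)) (binom x i) (binom y (suc n ∸ i)) ⟩
    ι i * binom x i * binom y (suc n ∸ i) + ι (suc n ∸ i) * binom x i * binom y (suc n ∸ i) ∎

-- Part (i), with n+1 in place of n ≥ 1.
weighted-vandermonde : ∀ n x y →
  Σ≤ (suc n) (λ i → (ι i - ι (suc n ∸ i)) * binom x i * binom y (suc n ∸ i)) ≡ (x - y) * binom (x + y - 1ℚ) n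
weighted-vandermonde n x y = begin
    Σ≤ (suc n) (λ i → (ι i - ι (suc n ∸ i)) * binom x i * binom y (suc n ∸ i))
      ≡⟨ Σ-cong (suc n) (λ i _ → solve 4 (λ a b c d → (a :- b) :* c :* d := a :* c :* d :- b :* c :* d) refl (ι i) (ι (suc n ∸ i)) (binom x i) (binom y (suc n ∸ i))) ⟩
    Σ≤ (suc n) (λ i → ι i * binom x i * binom y (suc n ∸ i) - ι (suc n ∸ i) * binom x i * binom y (suc n ∸ i))
      ≡⟨ Σ-- (suc n) _ _ ⟩
    Σ≤ (suc n) (λ i → ι i * binom x i * binom y (suc n ∸ i)) - Σ≤ (suc n) (λ i → ι (suc n ∸ i) * binom x i * binom y (suc n ∸ i))
      ≡⟨ cong₂ _-_ (Σ-weighted-left n x y) (Σ-weighted-right n x y) ⟩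
    x * convolution n (x - 1ℚ) y - y * convolution n x (y - 1ℚ)
      ≡⟨ cong₂ (λ a b → x * a - y * b) (vandermonde n (x - 1ℚ) y) (vandermonde n x (y - 1ℚ)) ⟩
    x * binom (x - 1ℚ + y) n - y * binom (x + (y - 1ℚ)) n
      ≡⟨ cong₂ (λ a b → x * binom a n - y * binom b n) (proj₁ (shifted-arguments x y)) (proj₂ (shifted-arguments x y)) ⟩
    x * binom (x + y - 1ℚ) n - y * binom (x + y - 1ℚ) n
      ≡⟨ solve 3 (λ x y b → x :* b :- y :* b := (x :- y) :* b) refl x y (binom (x + y - 1ℚ) n) ⟩
    (x - y) * binom (x + y - 1ℚ) n ∎

IsInt : ℚ → Set
IsInt a = Σ ℤ λ m → a ≡ emb m

int-ι : ∀ n → IsInt (ι n)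
int-ι n = + n , refl

int-+ : ∀ {a b} → IsInt a → IsInt b → IsInt (a + b)
int-+ (m , refl) (n , refl) = m ℤ.+ n , sym (emb-+ m n)

int-* : ∀ {a b} → IsInt a → IsInt b → IsInt (a * b)
int-* (m , refl) (n , refl) = m ℤ.* n , sym (emb-* m n)

int-- : ∀ {a b} → IsInt a → IsInt b → IsInt (a - b)
int-- (m , refl) (n , refl) = m ℤ.- n , sym (emb-- m n)

IntegerValued : ℚ → Set
IntegerValued a = ∀ k → IsInt (binom a k)

integerValued-suc : ∀ {a} → IntegerValued a → IntegerValued (a + 1ℚ)
integerValued-suc C[a] zero    = int-ι 1
integerValued-suc C[a] (suc k) = subst IsInt (sym (pascal _ k)) (int-+ (C[a] (suc k)) (C[a] k))

integerValued-pred : ∀ {a} → IntegerValued (a + 1ℚ) → IntegerValued a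
integerValued-pred         C[a+1] zero    = int-ι 1
integerValued-pred {a = a} C[a+1] (suc k) = subst IsInt difference (int-- (C[a+1] (suc k)) (integerValued-pred C[a+1] k))
  where
  difference : binom (a + 1ℚ) (suc k) - binom a k ≡ binom a (suc k)
  difference = trans (cong (_- binom a k) (pascal a k))
                     (solve 2 (λ u v → u :+ v :- v := u) refl (binom a (suc k)) (binom a k))

integerValued-zero : IntegerValued 0ℚ
integerValued-zero zero    = int-ι 1
integerValued-zero (suc k) = subst IsInt (sym (binom-vanishes {0} {suc k} (s≤s z≤n))) (int-ι 0)

integerValued : ∀ m → IntegerValued (emb m)
integerValued (+ zero)             = integerValued-zero
integerValued (+ suc n)            = subst IntegerValued (sym (ι-suc n)) (integerValued-suc (integerValued (+ n)))
integerValued -[1+ zero  ]         = integerValued-pred (subst IntegerValued (emb-+ -[1+ 0 ] (+ 1)) integerValued-zero)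
integerValued -[1+ suc n ]         = integerValued-pred (subst IntegerValued (emb-+ -[1+ suc n ] (+ 1)) (integerValued -[1+ n ]))

-- X is an integral multiple of d, i.e. X ≡ 0 (mod d) when X ∈ ℤ.
Multiple : ℕ → ℚ → Set
Multiple d X = Σ ℤ λ m → X ≡ ι d * emb m

multiple : ∀ d {a} → IsInt a → Multiple d (ι d * a)
multiple d (m , a≡m) = m , cong (ι d *_) a≡m

multiple-square : ∀ d {a} → IsInt a → Multiple (d ℕ.* d) (ι d * ι d * a)
multiple-square d {a} int-a = subst (λ c → Multiple (d ℕ.* d) (c * a)) (ι-* d d) (multiple (d ℕ.* d) int-a)

multiple-+ : ∀ d {X Y} → Multiple d X → Multiple d Y → Multiple d (X + Y)
multiple-+ d (m , refl) (n , refl) =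
  m ℤ.+ n , trans (sym (ℚP.*-distribˡ-+ (ι d) (emb m) (emb n))) (cong (ι d *_) (sym (emb-+ m n)))

multiple-* : ∀ d {a X} → IsInt a → Multiple d X → Multiple d (a * X)
multiple-* d (k , refl) (m , refl) =
  k ℤ.* m , trans (solve 3 (λ k d m → k :* (d :* m) := d :* (k :* m)) refl (emb k) (ι d) (emb m))
                  (cong (ι d *_) (sym (emb-* k m)))

multiple-- : ∀ d {X Y} → Multiple d X → Multiple d Y → Multiple d (X - Y)
multiple-- d {Y = Y} X-mult Y-mult =
  multiple-+ d X-mult (subst (Multiple d) (solve 1 (λ y → con (- 1ℚ) :* y := :- y) refl Y)
                             (multiple-* d {a = - 1ℚ} (-[1+ 0 ] , refl) Y-mult))

multiple-weaken : ∀ d e {X} → Multiple (d ℕ.* e) X → Multiple d X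
multiple-weaken d e (m , refl) =
  + e ℤ.* m , trans (cong (_* emb m) (ι-* d e)) (trans (ℚP.*-assoc (ι d) (ι e) (emb m)) (cong (ι d *_) (sym (emb-* (+ e) m))))

multiple-scale : ∀ e {d X} → Multiple d X → Multiple (e ℕ.* d) (ι e * X)
multiple-scale e {d} (m , refl) = m , trans (sym (ℚP.*-assoc (ι e) (ι d) (emb m))) (cong (_* emb m) (sym (ι-* e d)))

multiple-cancel : ∀ {d c Y} → Coprime d c → IsInt Y → Multiple d (ι c * Y) → Multiple d Y
multiple-cancel {d} {c} d⊥c (y , refl) (m , cy≡dm) with ∣ᵤ⇒∣ {+ d} {y} (ℤCoprime.coprime-divisor (+ d) (+ c) y d⊥c d∣cy)
  where
  cy≡dm-in-ℤ : + c ℤ.* y ≡ + d ℤ.* m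
  cy≡dm-in-ℤ = emb-injective (trans (emb-* (+ c) y) (trans cy≡dm (sym (emb-* (+ d) m))))
  d∣cy : + d ℤDiv.∣ + c ℤ.* y
  d∣cy = ℤDiv.divides ℤ.∣ m ∣ (trans (cong ℤ.∣_∣ cy≡dm-in-ℤ) (trans (ℤP.abs-* (+ d) m) (ℕP.*-comm d ℤ.∣ m ∣)))
... | divides q y≡qd = q , trans (cong emb y≡qd) (trans (emb-* q (+ d)) (ℚP.*-comm (emb q) (ι d)))

coprime-* : ∀ {a b n} → Coprime a n → Coprime b n → Coprime (a ℕ.* b) n
coprime-* {a} a⊥n b⊥n {k} (k∣ab , k∣n) = b⊥n (coprime-divisor k⊥a k∣ab , k∣n)
  where
  k⊥a : Coprime k a
  k⊥a (l∣k , l∣a) = a⊥n (l∣a , ∣-trans l∣k k∣n)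

coprime-below-prime : ∀ {p} → Prime p → ∀ c → suc c < p → Coprime p (suc c)
coprime-below-prime p-prime c c<p = prime⇒coprime p-prime c<p

coprime-below-prime² : ∀ {p} → Prime p → ∀ c → suc c < p → Coprime (p ℕ.* p) (suc c)
coprime-below-prime² p-prime c c<p = coprime-* (coprime-below-prime p-prime c c<p) (coprime-below-prime p-prime c c<p)

binomial-product-integral : ∀ p i j → IsInt (binom (ι p - 1ℚ) i * binom (- ι p - 1ℚ) j)
binomial-product-integral p i j =
  int-* (subst IntegerValued upper (integerValued (+ p ℤ.- + 1)) i)
        (subst IntegerValued lower (integerValued (ℤ.- + p ℤ.- + 1)) j)
  where
  upper : emb (+ p ℤ.- + 1) ≡ ι p - 1ℚ
  upper = emb-- (+ p) (+ 1)
  lower : emb (ℤ.- + p ℤ.- + 1) ≡ - ι p - 1ℚ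
  lower = trans (emb-- (ℤ.- + p) (+ 1)) (cong (_- 1ℚ) (emb-neg (+ p)))

KeyCongruence : ℕ → ℕ → ℕ → Set
KeyCongruence p i j = Multiple (p ℕ.* p) (ι (suc i) * (binom (ι p - 1ℚ) i * binom (- ι p - 1ℚ) j + 1ℚ) + ι p)

-- For j = 0 we have p = i+2 and z = C(i+1,i) = i+1, so (i+1)(i+2) + (i+2) = p².
key-congruence-base : ∀ {p} i → i ℕ.+ 0 ℕ.+ 2 ≡ p → KeyCongruence p i 0
key-congruence-base {p} i i+2≡p = + 1 , (begin
    ι (suc i) * (binom (ι p - 1ℚ) i * 1ℚ + 1ℚ) + ι p
      ≡⟨ cong (λ t → ι (suc i) * (binom t i * 1ℚ + 1ℚ) + ι p) p-1≡i+1 ⟩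
    ι (suc i) * (binom (ι (suc i)) i * 1ℚ + 1ℚ) + ι p
      ≡⟨ cong₂ (λ t u → ι (suc i) * (t * 1ℚ + 1ℚ) + u) (binom-subdiagonal i) p≡i+2 ⟩
    ι (suc i) * (ι (suc i) * 1ℚ + 1ℚ) + (ι (suc i) + 1ℚ)
      ≡⟨ solve 1 (λ a → a :* (a :* con 1ℚ :+ con 1ℚ) :+ (a :+ con 1ℚ) := (a :+ con 1ℚ) :* (a :+ con 1ℚ) :* con 1ℚ) refl (ι (suc i)) ⟩
    (ι (suc i) + 1ℚ) * (ι (suc i) + 1ℚ) * 1ℚ
      ≡⟨ cong (λ t → t * t * 1ℚ) (sym p≡i+2) ⟩
    ι p * ι p * 1ℚ
      ≡⟨ cong (_* 1ℚ) (sym (ι-* p p)) ⟩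
    ι (p ℕ.* p) * emb (+ 1) ∎)
  where
  p≡i+2 : ι p ≡ ι (suc i) + 1ℚ
  p≡i+2 = trans (cong ι (trans (sym i+2≡p) (trans (cong (ℕ._+ 2) (ℕP.+-identityʳ i)) (ℕP.+-comm i 2))))
                (ι-suc (suc i))
  p-1≡i+1 : ι p - 1ℚ ≡ ι (suc i)
  p-1≡i+1 = trans (cong (_- 1ℚ) p≡i+2) (solve 1 (λ a → a :+ con 1ℚ :- con 1ℚ := a) refl (ι (suc i)))

-- With P = I+J+3, and z, z' related as
-- consecutive products by binom-product-ratio, (J+1)(J+2)(I+2) times the
-- congruence expression T at (I, J+1) equals P²R minus a multiple of the
-- expression T' at (I+1, J), where R = I² + (I+2)P - 2.
key-step-identity : ∀ {I J P I₁ I₂ J₁ J₂ z z'} →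
  I₁ ≡ I + 1ℚ → I₂ ≡ I + ι 2 → J₁ ≡ J + 1ℚ → J₂ ≡ J + ι 2 → P ≡ I + J + ι 3 →
  z' * I₁ * ((- P - 1ℚ) - J) ≡ z * ((P - 1ℚ) - I) * J₁ →
  J₁ * (J₂ * (I₂ * (I₁ * (z + 1ℚ) + P)))
    ≡ P * P * (I * I + I₂ * P - ι 2) - I₁ * I₁ * (P + J₁) * (I₂ * (z' + 1ℚ) + P)
key-step-identity {I} {J} {z = z} {z'} refl refl refl refl refl ratio = begin
    J₁ * (J₂ * (I₂ * (I₁ * (z + 1ℚ) + P)))
      ≡⟨ solve 4 (λ I J z z' → let one = con 1ℚ ; two = con (ι 2) ; P = I :+ J :+ con (ι 3)
                                   I₁ = I :+ one ; I₂ = I :+ two ; J₁ = J :+ one ; J₂ = J :+ two in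
           J₁ :* (J₂ :* (I₂ :* (I₁ :* (z :+ one) :+ P)))
             := I₂ :* I₁ :* (z :* ((P :- one) :- I) :* J₁ :- z' :* I₁ :* ((:- P :- one) :- J))
                :+ (P :* P :* (I :* I :+ I₂ :* P :- two) :- I₁ :* I₁ :* (P :+ J₁) :* (I₂ :* (z' :+ one) :+ P)))
           refl I J z z' ⟩
    I₂ * I₁ * (z * ((P - 1ℚ) - I) * J₁ - z' * I₁ * ((- P - 1ℚ) - J)) + RHS
      ≡⟨ cong (λ t → I₂ * I₁ * (t - z' * I₁ * ((- P - 1ℚ) - J)) + RHS) (sym ratio) ⟩
    I₂ * I₁ * (z' * I₁ * ((- P - 1ℚ) - J) - z' * I₁ * ((- P - 1ℚ) - J)) + RHS
      ≡⟨ solve 3 (λ c w r → c :* (w :- w) :+ r := r) refl (I₂ * I₁) (z' * I₁ * ((- P - 1ℚ) - J)) RHS ⟩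
    RHS ∎
  where
  P I₁ I₂ J₁ J₂ RHS : ℚ
  P   = I + J + ι 3
  I₁  = I + 1ℚ
  I₂  = I + ι 2
  J₁  = J + 1ℚ
  J₂  = J + ι 2
  RHS = P * P * (I * I + I₂ * P - ι 2) - I₁ * I₁ * (P + J₁) * (I₂ * (z' + 1ℚ) + P)

step-factors-below : ∀ {p} i j → i ℕ.+ j ℕ.+ 3 ≡ p → suc j < p × suc (suc j) < p × suc (suc i) < p
step-factors-below i j refl rewrite ℕP.+-comm (i ℕ.+ j) 3 =
    s≤s (s≤s (ℕP.m≤n⇒m≤1+n (ℕP.m≤n+m j i)))
  , s≤s (s≤s (s≤s (ℕP.m≤n+m j i)))
  , s≤s (s≤s (s≤s (ℕP.m≤m+n i j)))

key-congruence : ∀ {p} → Prime p → ∀ j i → i ℕ.+ j ℕ.+ 2 ≡ p → KeyCongruence p i j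
key-congruence p-prime zero    i i+2≡p   = key-congruence-base i i+2≡p
key-congruence {p} p-prime (suc j) i i+[j+1]+2≡p =
  multiple-cancel (coprime-below-prime² p-prime (suc i) i+2<p) T-integral
    (multiple-cancel (coprime-below-prime² p-prime (suc j) j+2<p) (int-* (int-ι (suc (suc i))) T-integral)
      (multiple-cancel (coprime-below-prime² p-prime j j+1<p) (int-* (int-ι (suc (suc j))) (int-* (int-ι (suc (suc i))) T-integral))
        (subst (Multiple (p ℕ.* p)) (sym step-identity)
               (multiple-- (p ℕ.* p) (multiple-square p R-integral) (multiple-* (p ℕ.* p) c-integral induction-hypothesis)))))
  where
  x y z T : ℚ
  x = ι p - 1ℚ
  y = - ι p - 1ℚ
  z = binom x i * binom y (suc j)
  T = ι (suc i) * (z + 1ℚ) + ι p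
  T-integral : IsInt T
  T-integral = int-+ (int-* (int-ι (suc i)) (int-+ (binomial-product-integral p i (suc j)) (int-ι 1))) (int-ι p)
  R-integral : IsInt (ι i * ι i + ι (suc (suc i)) * ι p - ι 2)
  R-integral = int-- (int-+ (int-* (int-ι i) (int-ι i)) (int-* (int-ι (suc (suc i))) (int-ι p))) (int-ι 2)
  c-integral : IsInt (ι (suc i) * ι (suc i) * (ι p + ι (suc j)))
  c-integral = int-* (int-* (int-ι (suc i)) (int-ι (suc i))) (int-+ (int-ι p) (int-ι (suc j)))
  i+j+3≡p : i ℕ.+ j ℕ.+ 3 ≡ p
  i+j+3≡p = trans (ℕP.+-suc (i ℕ.+ j) 2) (trans (cong (ℕ._+ 2) (sym (ℕP.+-suc i j))) i+[j+1]+2≡p)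
  p≡i+j+3 : ι p ≡ ι i + ι j + ι 3
  p≡i+j+3 = trans (cong ι (sym i+j+3≡p)) (trans (ι-+ (i ℕ.+ j) 3) (cong (_+ ι 3) (ι-+ i j)))
  j+1<p : suc j < p
  j+1<p = proj₁ (step-factors-below i j i+j+3≡p)
  j+2<p : suc (suc j) < p
  j+2<p = proj₁ (proj₂ (step-factors-below i j i+j+3≡p))
  i+2<p : suc (suc i) < p
  i+2<p = proj₂ (proj₂ (step-factors-below i j i+j+3≡p))
  induction-hypothesis : KeyCongruence p (suc i) j
  induction-hypothesis = key-congruence p-prime j (suc i) (trans (cong (ℕ._+ 2) (sym (ℕP.+-suc i j))) i+[j+1]+2≡p)
  step-identity : ι (suc j) * (ι (suc (suc j)) * (ι (suc (suc i)) * T))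
    ≡ ι p * ι p * (ι i * ι i + ι (suc (suc i)) * ι p - ι 2)
      - ι (suc i) * ι (suc i) * (ι p + ι (suc j)) * (ι (suc (suc i)) * (binom x (suc i) * binom y j + 1ℚ) + ι p)
  step-identity = key-step-identity {ι i} {ι j} {z = z} {z' = binom x (suc i) * binom y j} (ι-suc i) (ι-2+ i) (ι-suc j) (ι-2+ j) p≡i+j+3 (binom-product-ratio x y i j)

final-identity : ∀ {I J P I₁} bx by → I₁ ≡ I + 1ℚ → P ≡ I + J + ι 2 →
  (I - J) * bx * by - (J - I - ι 2 * P) ≡ ι 2 * (I₁ * (bx * by + 1ℚ) + P) - P * (bx * by + 1ℚ)
final-identity {I} {J} bx by refl refl =
  solve 4 (λ I J bx by → let P = I :+ J :+ con (ι 2) in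
            (I :- J) :* bx :* by :- (J :- I :- con (ι 2) :* P)
              := con (ι 2) :* ((I :+ con 1ℚ) :* (bx :* by :+ con 1ℚ) :+ P) :- P :* (bx :* by :+ con 1ℚ))
          refl I J bx by

binomial-congruence : ∀ {p} → Prime p → ∀ i j → i ℕ.+ j ℕ.+ 2 ≡ p →
  Multiple (p ℕ.* p) ((ι i - ι j) * binom (ι p - 1ℚ) i * binom (- ι p - 1ℚ) j - (ι j - ι i - ι 2 * ι p))
binomial-congruence {p} p-prime i j i+j+2≡p =
  subst (Multiple (p ℕ.* p)) (sym (final-identity {ι i} {ι j} (binom (ι p - 1ℚ) i) (binom (- ι p - 1ℚ) j) (ι-suc i) p≡i+j+2))
        (multiple-- (p ℕ.* p) (multiple-* (p ℕ.* p) (int-ι 2) key) (multiple-scale p z+1-multiple))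
  where
  z : ℚ
  z = binom (ι p - 1ℚ) i * binom (- ι p - 1ℚ) j
  key : KeyCongruence p i j
  key = key-congruence p-prime j i i+j+2≡p
  p≡i+j+2 : ι p ≡ ι i + ι j + ι 2
  p≡i+j+2 = trans (cong ι (sym i+j+2≡p)) (trans (ι-+ (i ℕ.+ j) 2) (cong (_+ ι 2) (ι-+ i j)))
  i+1<p : suc i < p
  i+1<p = subst (suc i <_) (trans (ℕP.+-comm 2 (i ℕ.+ j)) i+j+2≡p) (s≤s (s≤s (ℕP.m≤m+n i j)))
  -- (i+1)(z+1) = T - p is divisible by p, and i+1 is prime to p.
  z+1-multiple : Multiple p (z + 1ℚ)
  z+1-multiple = multiple-cancel (coprime-below-prime p-prime i i+1<p) (int-+ (binomial-product-integral p i j) (int-ι 1))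
    (subst (Multiple p) (solve 2 (λ a q → a :+ q :- q :* con 1ℚ := a) refl (ι (suc i) * (z + 1ℚ)) (ι p))
           (multiple-- p (multiple-weaken p p key) (multiple p (int-ι 1))))

lemma2p3 :
    (∀ (n : ℕ) → 1 ℕ.≤ n → ∀ (x y : ℚ) →
      Σ≤ n (λ i → (ι i - ι (n ∸ i)) * binom x i * binom y (n ∸ i))
        ≡ (x - y) * binom (x + y - ι 1) (n ∸ 1))
    ×
    (∀ (p : ℕ) → Prime p → p ≢ 2 → ∀ (i j : ℕ) → i ℕ.+ j ≡ p ∸ 2 →
      ∃ λ (m : ℤ) →
        (ι i - ι j) * binom (ι p - ι 1) i * binom (- ι p - ι 1) j
          - (ι j - ι i - ι 2 * ι p)
          ≡ ι (p ℕ.* p) * (m / 1))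
lemma2p3 = (λ { (suc n) _ x y → weighted-vandermonde n x y })
         , λ p p-prime _ i j i+j≡p-2 →
             binomial-congruence p-prime i j
               (trans (cong (ℕ._+ 2) i+j≡p-2) (ℕP.m∸n+n≡m (ℕ.nonTrivial⇒n>1 p {{prime⇒nonTrivial p-prime}})))
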